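{- The inequality $\neg\Box a\leq\Diamond\neg a$ (for all $a$) is independent of the inequalities $\Diamond\neg a\leq\neg\Box a$, $\Box\neg a\leq\neg\Diamond a$, and $\neg\Diamond a\leq\Box\neg a$ (for all $a$) over Heyting algebras $H$ equipped with a multiplicative $\Box$ and additive $\Diamond$, even assuming $\Box a\leq\Diamond a$ for all $a\in H$: there is such an algebra satisfying the latter three inequalities and $\Box a\leq\Diamond a$ but not the first.
   Context: In a Heyting algebra, $\neg a=a\to0$ (pseudocomplement). Multiplicative: $\Box$ preserves finite meets; additive: $\Diamond$ preserves finite joins. -}

module Defs where

open import Level using (Level; _⊔_)
open import Data.Product using (_×_)
open import Relation.Nullary using (¬_)
open import Relation.Binary.Lattice.Bundles using (HeytingAlgebra)

module _ {c ℓ₁ ℓ₂ : Level} (H : HeytingAlgebra c ℓ₁ ℓ₂) where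
  open HeytingAlgebra H

  neg : Carrier → Carrier
  neg a = a ⇨ ⊥

  Multiplicative : (Carrier → Carrier) → Set (c ⊔ ℓ₁)
  Multiplicative □ =
    (∀ {a b} → a ≈ b → □ a ≈ □ b) ×
    (□ ⊤ ≈ ⊤) ×
    (∀ a b → □ (a ∧ b) ≈ (□ a ∧ □ b))

  Additive : (Carrier → Carrier) → Set (c ⊔ ℓ₁)
  Additive ◇ =
    (∀ {a b} → a ≈ b → ◇ a ≈ ◇ b) ×
    (◇ ⊥ ≈ ⊥) ×
    (∀ a b → ◇ (a ∨ b) ≈ (◇ a ∨ ◇ b))

  module _ (□ ◇ : Carrier → Carrier) where
    Ineq1 : Set (c ⊔ ℓ₂)
    Ineq1 = ∀ a → neg (□ a) ≤ ◇ (neg a)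
    Ineq2 : Set (c ⊔ ℓ₂)
    Ineq2 = ∀ a → ◇ (neg a) ≤ neg (□ a)
    Ineq3 : Set (c ⊔ ℓ₂)
    Ineq3 = ∀ a → □ (neg a) ≤ neg (◇ a)
    Ineq4 : Set (c ⊔ ℓ₂)
    Ineq4 = ∀ a → neg (◇ a) ≤ □ (neg a)
    BoxLeDia : Set (c ⊔ ℓ₂)
    BoxLeDia = ∀ a → □ a ≤ ◇ a

-- Take the three-element chain 0 < m < 1 with ◇ the identity and □ sending
-- everything below 1 to 0. Since □ is deflationary, □a ≤ ◇a, and ¬ is
-- antitone, the inequalities ◇¬a ≤ ¬□a and □¬a ≤ ¬◇a hold. On a chain ¬ only
-- takes the values 0 and 1, both fixed by □, so ¬◇a ≤ □¬a holds as well.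
-- But ¬□m = ¬0 = 1 while ◇¬m = ¬m = 0.
module Submission where

open import Defs
open import Level using (0ℓ)
open import Data.Empty using (⊥-elim)
open import Data.Fin using (Fin; zero; suc)
open import Data.Fin.Properties using (≤-decTotalOrder; ≤fromℕ)
open import Data.Nat using (z≤n)
open import Data.Product using (Σ; _×_; _,_)
open import Data.Sum using ([_,_]′)
open import Function using (id)
open import Relation.Nullary using (¬_; yes; no)
open import Relation.Binary.Bundles using (DecTotalOrder)
open import Relation.Binary.Definitions using (Maximum; Minimum)
open import Relation.Binary.Lattice.Bundles using (HeytingAlgebra)
open import Relation.Binary.PropositionalEquality using (_≡_; refl; cong)
import Relation.Binary.Lattice.Properties.HeytingAlgebra as HeytingAlgebraProperties

module BoundedChain {a ℓ₁ ℓ₂} (O : DecTotalOrder a ℓ₁ ℓ₂)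
                    {⊤ ⊥ : DecTotalOrder.Carrier O}
                    (⊤-maximum : Maximum (DecTotalOrder._≤_ O) ⊤)
                    (⊥-minimum : Minimum (DecTotalOrder._≤_ O) ⊥) where

  open DecTotalOrder O renaming (refl to ≤-refl)
  open import Algebra.Construct.NaturalChoice.Min totalOrder using (_⊓_; x⊓y≤x; x⊓y≤y; ⊓-glb)
  open import Algebra.Construct.NaturalChoice.Max totalOrder using (_⊔_; x≤x⊔y; x≤y⊔x; ⊔-lub)

  infixr 5 _⇨_
  _⇨_ : Carrier → Carrier → Carrier
  x ⇨ y with x ≤? y
  ... | yes _ = ⊤
  ... | no  _ = y

  x⊓y≤z⇒y≰z⇒x≤z : ∀ {x y z} → x ⊓ y ≤ z → ¬ y ≤ z → x ≤ z
  x⊓y≤z⇒y≰z⇒x≤z {x} {y} {z} x⊓y≤z y≰z = [ x≤y⇒x≤z , y≤x⇒x≤z ]′ (total x y)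
    where
    x≤y⇒x≤z : x ≤ y → x ≤ z
    x≤y⇒x≤z x≤y = trans (⊓-glb ≤-refl x≤y) x⊓y≤z
    y≤x⇒x≤z : y ≤ x → x ≤ z
    y≤x⇒x≤z y≤x = ⊥-elim (y≰z (trans (⊓-glb y≤x ≤-refl) x⊓y≤z))

  ⇨-exponential : ∀ w x y → (w ⊓ x ≤ y → w ≤ x ⇨ y) × (w ≤ x ⇨ y → w ⊓ x ≤ y)
  ⇨-exponential w x y with x ≤? y
  ... | yes x≤y = (λ _ → ⊤-maximum w) , (λ _ → trans (x⊓y≤y w x) x≤y)
  ... | no  x≰y = (λ w⊓x≤y → x⊓y≤z⇒y≰z⇒x≤z w⊓x≤y x≰y) , (λ w≤y → trans (x⊓y≤x w x) w≤y)

  heytingAlgebra : HeytingAlgebra a ℓ₁ ℓ₂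
  heytingAlgebra = record
    { _∨_ = _⊔_ ; _∧_ = _⊓_ ; _⇨_ = _⇨_ ; ⊤ = ⊤ ; ⊥ = ⊥
    ; isHeytingAlgebra = record
      { isBoundedLattice = record
        { isLattice = record
          { isPartialOrder = isPartialOrder
          ; supremum = λ x y → x≤x⊔y x y , x≤y⊔x x y , λ _ → ⊔-lub
          ; infimum  = λ x y → x⊓y≤x x y , x⊓y≤y x y , λ _ → ⊓-glb
          }
        ; maximum = ⊤-maximum
        ; minimum = ⊥-minimum
        }
      ; exponential = ⇨-exponential
      }
    }

module _ {c ℓ₁ ℓ₂} (H : HeytingAlgebra c ℓ₁ ℓ₂) where
  open HeytingAlgebra H
  open HeytingAlgebraProperties H using (⇨ˡ-contravariant)

  id-additive : Additive H id
  id-additive = id , Eq.refl , λ _ _ → Eq.refl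

  module _ {□ : Carrier → Carrier} (□-deflationary : ∀ a → □ a ≤ a) where

    deflationary⇒Ineq2 : Ineq2 H □ id
    deflationary⇒Ineq2 a = ⇨ˡ-contravariant (□-deflationary a)

    deflationary⇒Ineq3 : Ineq3 H □ id
    deflationary⇒Ineq3 a = □-deflationary (neg H a)

threeChain : HeytingAlgebra 0ℓ 0ℓ 0ℓ
threeChain = BoundedChain.heytingAlgebra (≤-decTotalOrder 3) ≤fromℕ (λ _ → z≤n)

open HeytingAlgebra threeChain using (_≤_; _∧_) renaming (refl to ≤-refl)

box : Fin 3 → Fin 3
box (suc (suc zero)) = suc (suc zero)
box _                = zero

box-deflationary : ∀ a → box a ≤ a
box-deflationary zero             = z≤n
box-deflationary (suc zero)       = z≤n
box-deflationary (suc (suc zero)) = ≤-refl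

box-∧ : ∀ a b → box (a ∧ b) ≡ box a ∧ box b
box-∧ zero             _                = refl
box-∧ (suc zero)       zero             = refl
box-∧ (suc zero)       (suc zero)       = refl
box-∧ (suc zero)       (suc (suc zero)) = refl
box-∧ (suc (suc zero)) zero             = refl
box-∧ (suc (suc zero)) (suc zero)       = refl
box-∧ (suc (suc zero)) (suc (suc zero)) = refl

box-multiplicative : Multiplicative threeChain box
box-multiplicative = cong box , refl , box-∧

box-Ineq4 : Ineq4 threeChain box id
box-Ineq4 zero             = ≤-refl
box-Ineq4 (suc zero)       = z≤n
box-Ineq4 (suc (suc zero)) = z≤n

box-¬Ineq1 : ¬ Ineq1 threeChain box id
box-¬Ineq1 ineq1 with ineq1 (suc zero)
... | ()

proposition4p5 : Σ (HeytingAlgebra 0ℓ 0ℓ 0ℓ) λ H → Σ (HeytingAlgebra.Carrier H → HeytingAlgebra.Carrier H) λ □ → Σ (HeytingAlgebra.Carrier H → HeytingAlgebra.Carrier H) λ ◇ →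
    Multiplicative H □ × Additive H ◇ × Ineq2 H □ ◇ × Ineq3 H □ ◇ × Ineq4 H □ ◇ × BoxLeDia H □ ◇ × ¬ Ineq1 H □ ◇
proposition4p5 =
  threeChain , box , id ,
  box-multiplicative ,
  id-additive threeChain ,
  deflationary⇒Ineq2 threeChain box-deflationary ,
  deflationary⇒Ineq3 threeChain box-deflationary ,
  box-Ineq4 ,
  box-deflationary ,
  box-¬Ineq1
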